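{- Let $m,k$ be integers with $2\le k<m$ and $\frac{m}{k-1}\ge 2$. Then $$P_k(m)\ge 2^{\lfloor m/(k-1)\rfloor-1}-1.$$
   Context: Write $[m]=\{1,\ldots,m\}$. For positive integers $N,m$ and a multiset $\mathcal{F}=\{C_1,\ldots,C_t\}$ of non-empty subsets of $[m]$ (repetitions allowed; members indexed by $[t]$), a resolution into $N$ classes is a partition $\{A_1,\ldots,A_N\}$ of $[t]$ into $N$ blocks such that for each $i$ the sets $C_j$, $j\in A_i$, are pairwise disjoint with union $[m]$. $\mathcal{F}$ is uniquely resolvable with respect to $(N,m)$ if it has exactly one resolution into $N$ classes (partitions regarded as unordered). For $2\le k\le m$, $P_k(m)$ is the largest integer $N$ such that there exists a uniquely resolvable multiset with respect to $(N,m)$ whose resolution consists of $N$ blocks each of size exactly $k$. -}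

module Defs where

open import Data.Nat using (ℕ; _≡ᵇ_)
open import Data.Fin using (Fin; _≟_)
open import Data.Fin.Subset using (Subset; _∈_; Nonempty; ∣_∣)
open import Data.Vec using (tabulate)
open import Data.Product using (Σ; ∃; ∃-syntax; _×_)
open import Function using (Surjective)
open import Function.Bundles using (_⇔_)
open import Relation.Binary.PropositionalEquality using (_≡_; _≢_)
open import Relation.Nullary using (¬_; does)

-- A family (multiset) F = {C_1,...,C_t} of subsets of [m], indexed by Fin t.
Family : ℕ → ℕ → Set
Family t m = Fin t → Subset m

-- A partition of [t] into N (non-empty, labelled) blocks, given by a
-- surjective block-assignment f : Fin t → Fin N; block i = f⁻¹(i).
IsResolution : ∀ {t m} → Family t m → (N : ℕ) → (Fin t → Fin N) → Set
IsResolution {t} {m} C N f =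
  Surjective _≡_ _≡_ f
  × (∀ (i : Fin N) →
       (∀ (j j' : Fin t) → f j ≡ i → f j' ≡ i → j ≢ j' →
          ∀ (x : Fin m) → ¬ (x ∈ C j × x ∈ C j'))
     × (∀ (x : Fin m) → ∃[ j ] (f j ≡ i × x ∈ C j)))

SamePartition : ∀ {t N} → (Fin t → Fin N) → (Fin t → Fin N) → Set
SamePartition {t} f g = ∀ (j j' : Fin t) → (f j ≡ f j') ⇔ (g j ≡ g j')

block : ∀ {t N} → (Fin t → Fin N) → Fin N → Subset t
block f i = tabulate (λ j → does (f j ≟ i))

-- There is a multiset of non-empty subsets of [m] that is uniquely
-- resolvable w.r.t. (N, m) and whose resolution has N blocks of size k.
Admissible : ℕ → ℕ → ℕ → Set
Admissible k N m =
  ∃[ t ] Σ (Family t m) λ C →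
    (∀ j → Nonempty (C j))
    × ∃[ f ] (IsResolution C N f
              × (∀ g → IsResolution C N g → SamePartition f g)
              × (∀ i → ∣ block f i ∣ ≡ k))

{-# OPTIONS --safe #-}
-- Put h = k - 1 and n = ⌊m / h⌋ - 1, and arrange (n + 1) h points of [m] in a grid
-- of n + 1 columns and h rows. Every nonzero binary word w of length n yields a
-- partition of [m] into parts 0, …, h: the point in row r of column 0 goes to part
-- r + 1, the point in row r of column c + 1 goes to part r if w_c = 1 and to part
-- r + 1 otherwise, and all other points go to part h. The multiset of all parts of
-- these 2^n - 1 partitions is resolved by its words.
--
-- In any resolution, each class contains, for every r, exactly one part r + 1:
-- the one containing the point in row r of column 0. The point in row r + 1 of
-- column c + 1 lies in exactly one of the parts r + 1 and r + 2 of the class, which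
-- forces them to have the same c-th digit; so all positive parts of a class come
-- from one word, different for different classes. A class also needs a part 0 to
-- cover the 1-digits of its word in row 0. As there are only 2^n - 1 parts 0, each
-- class has exactly one, which must then cover all these 1-digits, and be the part 0
-- of the same word.
module Submission where

open import Defs
open import Data.Nat using (ℕ; suc; _≤_; _<_; _*_; _∸_; _^_)
open import Data.Nat.DivMod using (_/_)
open import Data.Product using (∃-syntax; _×_)

open import Data.Nat using (zero; _+_; s≤s; z≤n)
import Data.Nat.Properties as ℕ
open import Data.Nat.Properties
  using (1+n≰n; m^n>0; m+[n∸m]≡n; m≤m+n; ≤-trans; ≤-refl; module ≤-Reasoning)
open import Data.Nat.DivMod using (m/n*n≤m; m≥n⇒m/n>0)
open import Data.Fin
  using (Fin; zero; suc; toℕ; inject₁; fromℕ; cast; _↑ˡ_; _↑ʳ_; splitAt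
        ; combine; remQuot; quotient; remainder; finToFun; funToFin; punchOut)
open import Data.Fin.Patterns using (0F; 1F)
open import Data.Fin.Properties
  using (_≟_; any?; suc-injective; injective⇒≤; punchOut-injective; toℕ-injective; toℕ-cast
        ; toℕ-↑ˡ; splitAt-↑ˡ; splitAt-↑ʳ; remQuot-combine; combine-remQuot
        ; funToFin-finToFin; finToFun-funToFin)
open import Data.Fin.Subset using (_∈_; Nonempty; ∣_∣; outside)
open import Data.Vec using (tabulate)
open import Data.Vec.Properties using (tabulate-cong; lookup∘tabulate; []=⇒lookup; lookup⇒[]=)
open import Data.Product using (∃; _,_; proj₁; proj₂; uncurry)
open import Data.Sum using (_⊎_; inj₁; inj₂; [_,_]′)
import Data.Sum as Sum
open import Data.Bool using (true; false)
open import Data.Empty using (⊥-elim)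
open import Function using (_∘_; id; const; Injective; Surjective)
open import Function.Bundles using (_⇔_; mk⇔; Equivalence)
open import Relation.Nullary using (¬_; Dec; yes; no; does; contradiction)
open import Relation.Nullary.Decidable using (dec-true)
open import Relation.Binary.PropositionalEquality
  using (_≡_; _≢_; _≗_; refl; sym; trans; cong; cong₂; subst; module ≡-Reasoning)

open Equivalence using (to; from)

injective⇒surjective : ∀ {n} (f : Fin n → Fin n) → Injective _≡_ _≡_ f →
                       ∀ y → ∃ λ x → f x ≡ y
injective⇒surjective {suc n} f f-injective y with any? (λ x → f x ≟ y)
... | yes hit = hit
... | no miss = contradiction (injective⇒≤ punched-injective) 1+n≰n
  where
  y≢f : ∀ x → y ≢ f x
  y≢f x y≡fx = miss (x , sym y≡fx)

  punched-injective : Injective _≡_ _≡_ (λ x → punchOut (y≢f x))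
  punched-injective = f-injective ∘ punchOut-injective (y≢f _) (y≢f _)

inject₁≢suc : ∀ {n} (i : Fin n) → inject₁ i ≢ suc i
inject₁≢suc zero    ()
inject₁≢suc (suc i) eq = inject₁≢suc i (suc-injective eq)

inject₁≡suc⇒constant : ∀ {n} {A : Set} (f : Fin (suc n) → A) →
                       (∀ i → f (inject₁ i) ≡ f (suc i)) → ∀ i → f i ≡ f zero
inject₁≡suc⇒constant {zero}  f step zero    = refl
inject₁≡suc⇒constant {suc n} f step zero    = refl
inject₁≡suc⇒constant {suc n} f step (suc i) =
  trans (sym (step i)) (inject₁≡suc⇒constant (f ∘ inject₁) (step ∘ inject₁) i)

exactly-one⇒≡ : ∀ {p q : Fin 2} → p ≡ 1F ⊎ q ≡ 0F → ¬ (p ≡ 1F × q ≡ 0F) → p ≡ q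
exactly-one⇒≡ {0F} {0F} _        _ = refl
exactly-one⇒≡ {1F} {1F} _        _ = refl
exactly-one⇒≡ {1F} {0F} _        not-both = ⊥-elim (not-both (refl , refl))
exactly-one⇒≡ {0F} {1F} (inj₁ ()) _
exactly-one⇒≡ {0F} {1F} (inj₂ ()) _

≡1⇔≡1⇒≡ : ∀ {p q : Fin 2} → p ≡ 1F ⇔ q ≡ 1F → p ≡ q
≡1⇔≡1⇒≡ {0F} {0F} _ = refl
≡1⇔≡1⇒≡ {1F} {1F} _ = refl
≡1⇔≡1⇒≡ {1F} {0F} p⇔q with () ← to p⇔q refl
≡1⇔≡1⇒≡ {0F} {1F} p⇔q with () ← from p⇔q refl

∈-tabulate-does : ∀ {n} {P : Fin n → Set} (P? : ∀ x → Dec (P x)) {x} →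
                  x ∈ tabulate (λ y → does (P? y)) ⇔ P x
∈-tabulate-does P? {x} = mk⇔
  (λ x∈ → does≡true⇒ (P? x) (trans (sym (lookup∘tabulate _ x)) ([]=⇒lookup x∈)))
  (λ Px → lookup⇒[]= x _ (trans (lookup∘tabulate _ x) (dec-true (P? x) Px)))
  where
  does≡true⇒ : ∀ {Q : Set} (Q? : Dec Q) → does Q? ≡ true → Q
  does≡true⇒ (yes q) _ = q

∣block∣-↑ : ∀ a {b N} (f : Fin (a + b) → Fin N) (i : Fin N) →
            ∣ block f i ∣ ≡ ∣ block (f ∘ (_↑ˡ b)) i ∣ + ∣ block (f ∘ (a ↑ʳ_)) i ∣
∣block∣-↑ zero    f i = refl
∣block∣-↑ (suc a) f i with does (f zero ≟ i)
... | true  = cong suc (∣block∣-↑ a (f ∘ suc) i)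
... | false = ∣block∣-↑ a (f ∘ suc) i

∣block∣-cong : ∀ {t N} {f f′ : Fin t → Fin N} → f ≗ f′ →
               ∀ i → ∣ block f i ∣ ≡ ∣ block f′ i ∣
∣block∣-cong f≗f′ i = cong ∣_∣ (tabulate-cong (λ j → cong (λ y → does (y ≟ i)) (f≗f′ j)))

∣block-id∣≡1 : ∀ {n} (i : Fin n) → ∣ block id i ∣ ≡ 1
∣block-id∣≡1 {suc n} zero = cong suc (∣nothing∣ n)
  where
  ∣nothing∣ : ∀ n → ∣ tabulate {n = n} (λ _ → outside) ∣ ≡ 0
  ∣nothing∣ zero    = refl
  ∣nothing∣ (suc n) = ∣nothing∣ n
∣block-id∣≡1 (suc i)      = ∣block-id∣≡1 i

∣block-remainder∣ : ∀ K {N} (i : Fin N) → ∣ block (remainder {K} N) i ∣ ≡ K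
∣block-remainder∣ zero        i = refl
∣block-remainder∣ (suc K) {N} i = begin
  ∣ block (remainder {suc K} N) i ∣
    ≡⟨ ∣block∣-↑ N (remainder N) i ⟩
  ∣ block (remainder {suc K} N ∘ (_↑ˡ K * N)) i ∣ + ∣ block (remainder {suc K} N ∘ (N ↑ʳ_)) i ∣
    ≡⟨ cong₂ _+_ (∣block∣-cong remainder-↑ˡ i) (∣block∣-cong remainder-↑ʳ i) ⟩
  ∣ block id i ∣ + ∣ block (remainder {K} N) i ∣
    ≡⟨ cong₂ _+_ (∣block-id∣≡1 i) (∣block-remainder∣ K i) ⟩
  suc K ∎
  where
  open ≡-Reasoning
  remainder-↑ˡ : ∀ a → remainder {suc K} N (a ↑ˡ K * N) ≡ a
  remainder-↑ˡ a = cong proj₂ (remQuot-combine {suc K} 0F a)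
  remainder-↑ʳ : ∀ j → remainder {suc K} N (N ↑ʳ j) ≡ remainder {K} N j
  remainder-↑ʳ j rewrite splitAt-↑ʳ N (K * N) j = refl

funToFin-cong : ∀ {m n} {f f′ : Fin m → Fin n} → f ≗ f′ → funToFin f ≡ funToFin f′
funToFin-cong {zero}  _     = refl
funToFin-cong {suc m} f≗f′ = cong₂ combine (f≗f′ zero) (funToFin-cong (f≗f′ ∘ suc))

finToFun-injective : ∀ m n {i j : Fin (m ^ n)} → finToFun {m} {n} i ≗ finToFun j → i ≡ j
finToFun-injective m n {i} {j} eq = begin
  i                             ≡⟨ funToFin-finToFin {n} {m} i ⟨
  funToFin {n} {m} (finToFun i) ≡⟨ funToFin-cong eq ⟩
  funToFin {n} {m} (finToFun j) ≡⟨ funToFin-finToFin {n} {m} j ⟩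
  j                             ∎
  where open ≡-Reasoning

toℕ-funToFin-0F : ∀ {m n} → toℕ (funToFin {m} {suc n} (const 0F)) ≡ 0
toℕ-funToFin-0F {zero}  = refl
toℕ-funToFin-0F {suc m} {n} =
  trans (toℕ-↑ˡ (funToFin {m} {suc n} (const 0F)) _) (toℕ-funToFin-0F {m})

-- Word number a is the binary expansion of a + 1, hence nonzero.
word : ∀ n → Fin (2 ^ n ∸ 1) → Fin n → Fin 2
word n a = finToFun (cast (m+[n∸m]≡n (m^n>0 2 n)) (suc a))

word-injective : ∀ n {a a′ : Fin (2 ^ n ∸ 1)} → word n a ≗ word n a′ → a ≡ a′
word-injective n {a} {a′} eq = toℕ-injective (ℕ.suc-injective (begin
  suc (toℕ a)           ≡⟨ toℕ-cast _ (suc a) ⟨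
  toℕ (cast _ (suc a))  ≡⟨ cong toℕ (finToFun-injective 2 n eq) ⟩
  toℕ (cast _ (suc a′)) ≡⟨ toℕ-cast _ (suc a′) ⟩
  suc (toℕ a′)          ∎))
  where open ≡-Reasoning

word-nonzero : ∀ n (a : Fin (2 ^ n ∸ 1)) → ∃[ c ] word n a c ≡ 1F
word-nonzero n a with any? (λ c → word n a c ≟ 1F)
... | yes hit = hit
... | no miss = contradiction suc≡0 λ ()
  where
  open ≡-Reasoning
  all-0F : word n a ≗ finToFun (funToFin {n} {2} (const 0F))
  all-0F c with word n a c in eq
  ... | 0F = sym (finToFun-funToFin (const 0F) c)
  ... | 1F = contradiction (c , eq) miss

  suc≡0 : suc (toℕ a) ≡ 0
  suc≡0 = begin
    suc (toℕ a)                       ≡⟨ toℕ-cast _ (suc a) ⟨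
    toℕ (cast _ (suc a))              ≡⟨ cong toℕ (finToFun-injective 2 n all-0F) ⟩
    toℕ (funToFin {n} {2} (const 0F)) ≡⟨ toℕ-funToFin-0F {n} ⟩
    0                                 ∎

module Resolution {t m N} {C : Family t m} {g : Fin t → Fin N} (res : IsResolution C N g) where

  cover : Fin N → Fin m → Fin t
  cover b x = proj₁ (proj₂ (proj₂ res b) x)

  g-cover : ∀ b x → g (cover b x) ≡ b
  g-cover b x = proj₁ (proj₂ (proj₂ (proj₂ res b) x))

  ∈-cover : ∀ b x → x ∈ C (cover b x)
  ∈-cover b x = proj₂ (proj₂ (proj₂ (proj₂ res b) x))

  unique-cover : ∀ {b j x} → g j ≡ b → x ∈ C j → j ≡ cover b x
  unique-cover {b} {j} {x} gj≡b x∈j with j ≟ cover b x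
  ... | yes j≡cover = j≡cover
  ... | no  j≢cover = contradiction (x∈j , ∈-cover b x)
                        (proj₁ (proj₂ res b) j (cover b x) gj≡b (g-cover b x) j≢cover x)

  meet-in-block⇒≡ : ∀ {b j j′ x} → g j ≡ b → g j′ ≡ b → x ∈ C j → x ∈ C j′ → j ≡ j′
  meet-in-block⇒≡ gj≡b gj′≡b x∈j x∈j′ =
    trans (unique-cover gj≡b x∈j) (sym (unique-cover gj′≡b x∈j′))

module Construction (h′ n e : ℕ) where

  h k N m t : ℕ
  h = suc h′
  k = suc h
  N = 2 ^ n ∸ 1
  m = suc n * h + e
  t = k * N

  columnDigit : Fin N → Fin (suc n) → Fin 2
  columnDigit a zero    = 0F
  columnDigit a (suc c) = word n a c

  shift : Fin 2 → Fin h → Fin k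
  shift 0F r = suc r
  shift 1F r = inject₁ r

  shift-injectiveˡ : ∀ {d d′ r} → shift d r ≡ shift d′ r → d ≡ d′
  shift-injectiveˡ {0F} {0F} _  = refl
  shift-injectiveˡ {1F} {1F} _  = refl
  shift-injectiveˡ {0F} {1F} {r} eq = contradiction (sym eq) (inject₁≢suc r)
  shift-injectiveˡ {1F} {0F} {r} eq = contradiction eq (inject₁≢suc r)

  part : Fin N → Fin m → Fin k
  part a = [ uncurry (shift ∘ columnDigit a) ∘ remQuot h , const (fromℕ h) ]′ ∘ splitAt (suc n * h)

  point : Fin (suc n) → Fin h → Fin m
  point c r = combine c r ↑ˡ e

  part-point : ∀ a c r → part a (point c r) ≡ shift (columnDigit a c) r
  part-point a c r rewrite splitAt-↑ˡ (suc n * h) (combine c r) e =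
    cong (uncurry (shift ∘ columnDigit a)) (remQuot-combine c r)

  type : Fin t → Fin k
  type = quotient N

  class : Fin t → Fin N
  class = remainder {k} N

  type-combine : ∀ (p : Fin k) (a : Fin N) → type (combine p a) ≡ p
  type-combine p a = cong proj₁ (remQuot-combine p a)

  class-combine : ∀ (p : Fin k) (a : Fin N) → class (combine p a) ≡ a
  class-combine p a = cong proj₂ (remQuot-combine p a)

  type-class-injective : ∀ {j j′} → type j ≡ type j′ → class j ≡ class j′ → j ≡ j′
  type-class-injective {j} {j′} eq eq′ =
    trans (sym (combine-remQuot {k} N j)) (trans (cong₂ combine eq eq′) (combine-remQuot {k} N j′))

  C : Family t m
  C j = tabulate (λ x → does (part (class j) x ≟ type j))

  ∈C⇔ : ∀ {j x} → x ∈ C j ⇔ part (class j) x ≡ type j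
  ∈C⇔ {j} = ∈-tabulate-does (λ x → part (class j) x ≟ type j)

  point∈C⇔ : ∀ {j c r} → point c r ∈ C j ⇔ shift (columnDigit (class j) c) r ≡ type j
  point∈C⇔ {j} {c} {r} = mk⇔
    (λ x∈ → trans (sym (part-point (class j) c r)) (to ∈C⇔ x∈))
    (λ eq → from ∈C⇔ (trans (part-point (class j) c r) eq))

  point∈C-shift : ∀ {j c d r} → type j ≡ shift d r → point (suc c) r ∈ C j ⇔ word n (class j) c ≡ d
  point∈C-shift {j} {c} {d} {r} type≡ = mk⇔
    (λ x∈ → shift-injectiveˡ (trans (to (point∈C⇔ {j} {suc c}) x∈) type≡))
    (λ d≡ → from (point∈C⇔ {j} {suc c}) (trans (cong (λ d′ → shift d′ r) d≡) (sym type≡)))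

  class-resolution : IsResolution C N class
  class-resolution = surjective , λ a → disjoint a , cover a
    where
    surjective : Surjective _≡_ _≡_ class
    surjective a = combine {k} 0F a , λ { refl → class-combine 0F a }

    disjoint : ∀ a j j′ → class j ≡ a → class j′ ≡ a → j ≢ j′ →
               ∀ x → ¬ (x ∈ C j × x ∈ C j′)
    disjoint a j j′ refl class≡ j≢j′ x (x∈j , x∈j′) = j≢j′ (type-class-injective
      (trans (sym (to ∈C⇔ x∈j)) (trans (cong (λ b → part b x) (sym class≡)) (to ∈C⇔ x∈j′)))
      (sym class≡))

    cover : ∀ a x → ∃[ j ] (class j ≡ a × x ∈ C j)
    cover a x = combine (part a x) a , class-combine (part a x) a , from ∈C⇔
      (trans (cong (λ b → part b x) (class-combine (part a x) a)) (sym (type-combine (part a x) a)))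

  class-blocks : ∀ a → ∣ block class a ∣ ≡ k
  class-blocks = ∣block-remainder∣ k

  C-nonempty : ∀ j → Nonempty (C j)
  C-nonempty j = nonempty (type j) refl
    where
    nonempty : ∀ p → type j ≡ p → Nonempty (C j)
    nonempty 0F      type≡ = let c , 1F≡ = word-nonzero n (class j) in
                             point (suc c) 0F , from (point∈C-shift {r = 0F} type≡) 1F≡
    nonempty (suc r) type≡ = point 0F r , from (point∈C⇔ {c = 0F}) (sym type≡)

  module Uniqueness {g : Fin t → Fin N} (g-resolution : IsResolution C N g) where
    open Resolution g-resolution

    same-set⇒same-block : ∀ {j j′ b b′} → g j ≡ b → g j′ ≡ b′ →
                          type j ≡ type j′ → class j ≡ class j′ → b ≡ b′
    same-set⇒same-block gj≡b gj′≡b′ type≡ class≡ =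
      trans (sym gj≡b) (trans (cong g (type-class-injective type≡ class≡)) gj′≡b′)

    rowSet : Fin N → Fin h → Fin t
    rowSet b r = cover b (point 0F r)

    g-rowSet : ∀ b r → g (rowSet b r) ≡ b
    g-rowSet b r = g-cover b (point 0F r)

    type-rowSet : ∀ b r → type (rowSet b r) ≡ suc r
    type-rowSet b r = sym (to (point∈C⇔ {c = 0F}) (∈-cover b (point 0F r)))

    ≡rowSet : ∀ {j b r} → g j ≡ b → type j ≡ suc r → j ≡ rowSet b r
    ≡rowSet gj≡b type≡ = unique-cover gj≡b (from (point∈C⇔ {c = 0F}) (sym type≡))

    type-cover-point : ∀ b c r → let j = cover b (point (suc c) r) in
                       type j ≡ shift (word n (class j) c) r
    type-cover-point b c r = sym (to (point∈C⇔ {c = suc c} {r}) (∈-cover b (point (suc c) r)))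

    cover≡rowSet : ∀ {b c r ρ} → let j = cover b (point (suc c) r) in
                   shift (word n (class j) c) r ≡ suc ρ → j ≡ rowSet b ρ
    cover≡rowSet {b} {c} {r} shift≡ = ≡rowSet (g-cover b _) (trans (type-cover-point b c r) shift≡)

    word-rowSet-step : ∀ b (r : Fin h′) c →
                       word n (class (rowSet b (inject₁ r))) c ≡ word n (class (rowSet b (suc r))) c
    word-rowSet-step b r c = exactly-one⇒≡ (Sum.map (to x∈lo⇔) (to x∈hi⇔) x∈lo⊎x∈hi)
      λ (lo-digit , hi-digit) → lo≢hi
        (meet-in-block⇒≡ (g-rowSet b _) (g-rowSet b _) (from x∈lo⇔ lo-digit) (from x∈hi⇔ hi-digit))
      where
      x : Fin m
      x = point (suc c) (suc r)

      lo hi : Fin t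
      lo = rowSet b (inject₁ r)
      hi = rowSet b (suc r)

      x∈lo⇔ : x ∈ C lo ⇔ word n (class lo) c ≡ 1F
      x∈lo⇔ = point∈C-shift (type-rowSet b (inject₁ r))

      x∈hi⇔ : x ∈ C hi ⇔ word n (class hi) c ≡ 0F
      x∈hi⇔ = point∈C-shift (type-rowSet b (suc r))

      lo≢hi : lo ≢ hi
      lo≢hi lo≡hi = inject₁≢suc r (suc-injective
        (trans (sym (type-rowSet b (inject₁ r))) (trans (cong type lo≡hi) (type-rowSet b (suc r)))))

      x∈lo⊎x∈hi : x ∈ C lo ⊎ x ∈ C hi
      x∈lo⊎x∈hi with word n (class (cover b x)) c in digit
      ... | 0F = inj₂ (subst (λ j → x ∈ C j)
                             (cover≡rowSet (cong (λ d → shift d (suc r)) digit)) (∈-cover b x))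
      ... | 1F = inj₁ (subst (λ j → x ∈ C j)
                             (cover≡rowSet (cong (λ d → shift d (suc r)) digit)) (∈-cover b x))

    blockClass : Fin N → Fin N
    blockClass b = class (rowSet b 0F)

    class-rowSet : ∀ b r → class (rowSet b r) ≡ blockClass b
    class-rowSet b = inject₁≡suc⇒constant (class ∘ rowSet b) (word-injective n ∘ word-rowSet-step b)

    blockClass-injective : Injective _≡_ _≡_ blockClass
    blockClass-injective {b} {b′} =
      same-set⇒same-block (g-rowSet b 0F) (g-rowSet b′ 0F)
        (trans (type-rowSet b 0F) (sym (type-rowSet b′ 0F)))

    blockClass-digit⇒base : ∀ b c → word n (blockClass b) c ≡ 1F →
                            ∃[ j ] (g j ≡ b × type j ≡ 0F × word n (class j) c ≡ 1F)
    blockClass-digit⇒base b c 1F≡ with word n (class (cover b (point (suc c) 0F))) c in digit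
    ... | 1F = cover b _ , g-cover b _
             , trans (type-cover-point b c 0F) (cong (λ d → shift d 0F) digit) , digit
    ... | 0F = contradiction 0F≡1F λ ()
      where
      open ≡-Reasoning
      0F≡1F : 0F ≡ 1F
      0F≡1F = begin
        0F                                              ≡⟨ digit ⟨
        word n (class (cover b (point (suc c) 0F))) c   ≡⟨ cong (λ j → word n (class j) c)
                                                             (cover≡rowSet (cong (λ d → shift d 0F) digit)) ⟩
        word n (blockClass b) c                         ≡⟨ 1F≡ ⟩
        1F                                              ∎

    base-digit⇒blockClass-digit : ∀ {j} c → type j ≡ 0F → word n (class j) c ≡ 1F →
                                  word n (blockClass (g j)) c ≡ 1F
    base-digit⇒blockClass-digit {j} c type≡ 1F≡ with word n (blockClass (g j)) c in digit
    ... | 1F = refl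
    ... | 0F = contradiction (trans (sym type≡) (trans (cong type j≡row) (type-rowSet (g j) 0F))) λ ()
      where
      j≡row : j ≡ rowSet (g j) 0F
      j≡row = meet-in-block⇒≡ refl (g-rowSet (g j) 0F)
        (from (point∈C-shift {r = 0F} type≡) 1F≡) (from (point∈C-shift (type-rowSet (g j) 0F)) digit)

    base-in-block : ∀ b → let c = proj₁ (word-nonzero n (blockClass b)) in
                    ∃[ j ] (g j ≡ b × type j ≡ 0F × word n (class j) c ≡ 1F)
    base-in-block b = blockClass-digit⇒base b _ (proj₂ (word-nonzero n (blockClass b)))

    baseSet : Fin N → Fin t
    baseSet b = proj₁ (base-in-block b)

    g-baseSet : ∀ b → g (baseSet b) ≡ b
    g-baseSet b = proj₁ (proj₂ (base-in-block b))

    type-baseSet : ∀ b → type (baseSet b) ≡ 0F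
    type-baseSet b = proj₁ (proj₂ (proj₂ (base-in-block b)))

    ≡baseSet : ∀ {j} → type j ≡ 0F → j ≡ baseSet (g j)
    ≡baseSet {j} type≡ with injective⇒surjective (class ∘ baseSet) class-baseSet-injective (class j)
      where
      class-baseSet-injective : Injective _≡_ _≡_ (class ∘ baseSet)
      class-baseSet-injective {b} {b′} = same-set⇒same-block (g-baseSet b) (g-baseSet b′)
        (trans (type-baseSet b) (sym (type-baseSet b′)))
    ... | b , class≡ = trans j≡ (cong baseSet (trans (sym (g-baseSet b)) (cong g (sym j≡))))
      where
      j≡ : j ≡ baseSet b
      j≡ = type-class-injective (trans type≡ (sym (type-baseSet b))) (sym class≡)

    class-baseSet : ∀ b → class (baseSet b) ≡ blockClass b
    class-baseSet b = word-injective n λ c → ≡1⇔≡1⇒≡ (mk⇔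
      (λ 1F≡ → subst (λ b′ → word n (blockClass b′) c ≡ 1F) (g-baseSet b)
                 (base-digit⇒blockClass-digit c (type-baseSet b) 1F≡))
      (λ 1F≡ → let j , gj≡b , type≡ , 1F≡′ = blockClass-digit⇒base b c 1F≡ in
               subst (λ i → word n (class i) c ≡ 1F)
                     (trans (≡baseSet type≡) (cong baseSet gj≡b)) 1F≡′))

    class≡blockClass : ∀ j → class j ≡ blockClass (g j)
    class≡blockClass j = by-type (type j) refl
      where
      by-type : ∀ p → type j ≡ p → class j ≡ blockClass (g j)
      by-type 0F      type≡ = trans (cong class (≡baseSet type≡)) (class-baseSet (g j))
      by-type (suc r) type≡ = trans (cong class (≡rowSet refl type≡)) (class-rowSet (g j) r)

    class-same-partition : SamePartition class g
    class-same-partition j j′ = mk⇔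
      (λ eq → blockClass-injective (trans (sym (class≡blockClass j)) (trans eq (class≡blockClass j′))))
      (λ eq → trans (class≡blockClass j) (trans (cong blockClass eq) (sym (class≡blockClass j′))))

  admissible : Admissible k N m
  admissible = t , C , C-nonempty , class , class-resolution
             , (λ _ g-resolution → Uniqueness.class-same-partition g-resolution) , class-blocks

lemma21 : ∀ (m k : ℕ) → 2 ≤ k → k < m → 2 * (k ∸ 1) ≤ m →
    ∃[ N ] (2 ^ (m / suc (k ∸ 2) ∸ 1) ∸ 1 ≤ N × Admissible k N m)
lemma21 m (suc (suc h′)) (s≤s (s≤s z≤n)) _ 2h≤m =
  2 ^ n ∸ 1 , ≤-refl , subst (Admissible (suc (suc h′)) (2 ^ n ∸ 1)) (m+[n∸m]≡n columns-fit)
                             (Construction.admissible h′ n (m ∸ suc n * h))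
  where
  h n : ℕ
  h = suc h′
  n = m / h ∸ 1

  columns-fit : suc n * h ≤ m
  columns-fit = begin
    suc (m / h ∸ 1) * h ≡⟨ cong (_* h) (m+[n∸m]≡n (m≥n⇒m/n>0 h≤m)) ⟩
    m / h * h           ≤⟨ m/n*n≤m m h ⟩
    m                   ∎
    where
    open ≤-Reasoning
    h≤m : h ≤ m
    h≤m = ≤-trans (m≤m+n h (h + 0)) 2h≤m
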